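{- Let $\phi:\mathbb{T}_3^{ -1}\to\mathbb{T}_3^{\infty}$ be the graph isomorphism sending the vertex $[\tfrac01,\tfrac11,\tfrac10]$ to $[\tfrac01,\tfrac{ -1}{1},\tfrac{ -1}{2}]$ and sending edges labeled $-1,0,\infty$ to edges labeled $\infty,-1,0$ respectively, and let $\psi:\mathbb{T}_3^{ -1}\to\mathbb{T}_3^{0}$ be the graph isomorphism sending $[\tfrac01,\tfrac11,\tfrac10]$ to $[\tfrac{ -2}{1},\tfrac{ -1}{1},\tfrac10]$ and sending edges labeled $-1,0,\infty$ to edges labeled $0,\infty,-1$ respectively. Then for every Farey triple $[q_0,q_{ -1},q_\infty]$ (written in parity order) in $\mathbb{T}_3^{ -1}$, $$\phi[q_0,q_{ -1},q_\infty]=\left[\frac{ -r(q_\infty)}{r(q_\infty)+d(q_\infty)},\ \frac{ -r(q_0)}{r(q_0)+d(q_0)},\ \frac{ -r(q_{ -1})}{r(q_{ -1})+d(q_{ -1})}\right],$$ $$\psi[q_0,q_{ -1},q_\infty]=\left[\frac{ -(r(q_{ -1})+d(q_{ -1}))}{d(q_{ -1})},\ \frac{ -(r(q_\infty)+d(q_\infty))}{d(q_\infty)},\ \frac{ -(r(q_0)+d(q_0))}{d(q_0)}\right].$$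
   Context: $\mathbb{Q}_\infty=\mathbb{Q}\cup\{\infty\}$, totally ordered with $\infty$ largest; a fraction $x/0$ with $x\neq0$ is read as $\infty$. For $q\in\mathbb{Q}_\infty$, $d(q),r(q)$ are the unique integers with $q=d(q)/r(q)$, $\gcd(d(q),r(q))=1$, $r(q)\ge0$ (so $0=0/1$, $\infty=1/0$). $\Delta(q,q')=|d(q)r(q')-d(q')r(q)|$; Farey neighbors: $\Delta=1$; then $q\oplus q'=\frac{d(q)+d(q')}{r(q)+r(q')}$ and $q\ominus q'=\frac{d(q)-d(q')}{r(q)-r(q')}$. A Farey triple is an unordered triple of pairwise Farey neighbors in $\mathbb{Q}_\infty$; with components $q_f<q_s<q_t$ its mutations are $\mu_f:[q_s,q_s\oplus q_t,q_t]$, $\mu_s:[q_f,q_f\ominus q_t,q_t]$, $\mu_t:[q_f,q_f\oplus q_s,q_s]$. Each Farey triple has exactly one component of each of the types $\frac{\text{even}}{\text{odd}}$, $\frac{\text{odd}}{\text{odd}}$, $\frac{\text{odd}}{\text{even}}$ (referring to the parities of $d(q),r(q)$); a Farey triple is written in parity order $[q_0,q_{ -1},q_\infty]$ with $q_0$ of type even/odd, $q_{ -1}$ of type odd/odd, $q_\infty$ of type odd/even. The mutation $\mu_0$ (resp. $\mu_{ -1}$, $\mu_\infty$) is the mutation replacing the component of type even/odd (resp. odd/odd, odd/even). The exchange graph (vertices Farey triples, edges single mutations) is a 3-regular tree $\mathbb{T}_3$; an edge is labeled $i\in\{0,-1,\infty\}$ if it corresponds to $\mu_i$. For $i\in\{0,-1,\infty\}$,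 $\mathbb{T}_3^i$ is the connected component of $\mathbb{T}_3$ minus the vertex $[\tfrac01,\tfrac{ -1}{1},\tfrac10]$ that contains $\mu_i[\tfrac01,\tfrac{ -1}{1},\tfrac10]$; thus $\mathbb{T}_3^{ -1}\ni[\tfrac01,\tfrac11,\tfrac10]$, $\mathbb{T}_3^{\infty}\ni[\tfrac01,\tfrac{ -1}{1},\tfrac{ -1}{2}]$, $\mathbb{T}_3^{0}\ni[\tfrac{ -2}{1},\tfrac{ -1}{1},\tfrac10]$. -}

module Defs where

open import Data.Bool using (Bool; true; false; if_then_else_; _∧_; _∨_)
open import Data.Nat as ℕ using (ℕ; suc)
open import Data.Nat.Divisibility using (_∣_)
open import Data.Integer as ℤ using (ℤ; +_; -[1+_]; ∣_∣)
open import Data.Rational as ℚ using (ℚ; ↥_; ↧ₙ_)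
import Data.Rational.Properties as ℚP
open import Data.Product using (_×_; Σ-syntax)
open import Relation.Nullary using (¬_)
open import Relation.Nullary.Decidable using (⌊_⌋)
open import Relation.Binary.PropositionalEquality using (_≡_; _≢_)

data ℚ∞ : Set where
  fin : ℚ → ℚ∞
  ∞   : ℚ∞

-- d(q), r(q): the coprime representation with r(q) ≥ 0 (∞ = 1/0)
d : ℚ∞ → ℤ
d (fin q) = ↥ q
d ∞       = + 1

r : ℚ∞ → ℤ
r (fin q) = + (↧ₙ q)
r ∞       = + 0

-- The element x/y of ℚ∞ (reduced, denominator made nonnegative);
-- x/0 is read as ∞ (for x ≠ 0; the meaningless 0/0 is also sent to ∞).
frac : ℤ → ℤ → ℚ∞
frac x (+ 0)        = ∞
frac x (+ (suc n))  = fin (x ℚ./ suc n)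
frac x -[1+ n ]     = fin ((ℤ.- x) ℚ./ suc n)

_<ᵇ_ : ℚ∞ → ℚ∞ → Bool
fin p <ᵇ fin q = ⌊ p ℚP.<? q ⌋
fin p <ᵇ ∞     = true
∞     <ᵇ _     = false

Δ : ℚ∞ → ℚ∞ → ℕ
Δ q q' = ∣ d q ℤ.* r q' ℤ.- d q' ℤ.* r q ∣

_⊕_ : ℚ∞ → ℚ∞ → ℚ∞
q ⊕ q' = frac (d q ℤ.+ d q') (r q ℤ.+ r q')

_⊖_ : ℚ∞ → ℚ∞ → ℚ∞
q ⊖ q' = frac (d q ℤ.- d q') (r q ℤ.- r q')

Even Odd : ℤ → Set
Even x = 2 ∣ ∣ x ∣
Odd  x = ¬ (2 ∣ ∣ x ∣)

EvenOdd OddOdd OddEven : ℚ∞ → Set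
EvenOdd q = Even (d q) × Odd (r q)
OddOdd  q = Odd (d q) × Odd (r q)
OddEven q = Odd (d q) × Even (r q)

record Triple : Set where
  constructor [_,_,_]
  field
    q₀ q₋₁ q∞ : ℚ∞
open Triple public

IsFareyTriple : Triple → Set
IsFareyTriple [ a , b , c ] =
  EvenOdd a × OddOdd b × OddEven c ×
  Δ a b ≡ 1 × Δ b c ≡ 1 × Δ a c ≡ 1

data Label : Set where
  ℓ0 ℓ-1 ℓ∞ : Label

-- New value of the component x of a Farey triple whose other two
-- components are y, z: if x = q_f or x = q_t the new value is the
-- ⊕ of the other two (μ_f, μ_t); if x = q_s it is q_f ⊖ q_t (μ_s).
-- (⊕ and ⊖ as defined are symmetric in their arguments.)
replace : ℚ∞ → ℚ∞ → ℚ∞ → ℚ∞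
replace x y z =
  if ((x <ᵇ y) ∧ (x <ᵇ z)) ∨ ((y <ᵇ x) ∧ (z <ᵇ x))
  then y ⊕ z
  else y ⊖ z

-- μ_i replaces the component of type i (the new component has the same type)
μ : Label → Triple → Triple
μ ℓ0  [ a , b , c ] = [ replace a b c , b , c ]
μ ℓ-1 [ a , b , c ] = [ a , replace b a c , c ]
μ ℓ∞  [ a , b , c ] = [ a , b , replace c a b ]

root : Triple
root = [ frac (+ 0) (+ 1) , frac (ℤ.- (+ 1)) (+ 1) , ∞ ]

-- 𝕋₃ⁱ : connected component of 𝕋₃ ∖ {root} containing μᵢ root
data In𝕋 (i : Label) : Triple → Set where
  base : In𝕋 i (μ i root)
  step : ∀ {t} (j : Label) → In𝕋 i t → μ j t ≢ root → In𝕋 i (μ j t)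

record IsGraphIso (j : Label) (v w : Triple) (σ : Label → Label)
                  (φ : Triple → Triple) : Set where
  field
    maps-to    : ∀ t → In𝕋 ℓ-1 t → In𝕋 j (φ t)
    injective  : ∀ t t' → In𝕋 ℓ-1 t → In𝕋 ℓ-1 t' → φ t ≡ φ t' → t ≡ t'
    surjective : ∀ u → In𝕋 j u → Σ[ t ∈ Triple ] (In𝕋 ℓ-1 t × φ t ≡ u)
    sends-base : φ v ≡ w
    edges      : ∀ t i → In𝕋 ℓ-1 t → In𝕋 ℓ-1 (μ i t) → φ (μ i t) ≡ μ (σ i) (φ t)

σφ : Label → Label
σφ ℓ-1 = ℓ∞
σφ ℓ0  = ℓ-1
σφ ℓ∞  = ℓ0

σψ : Label → Label
σψ ℓ-1 = ℓ0
σψ ℓ0  = ℓ∞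
σψ ℓ∞  = ℓ-1

v₋₁ w∞ w₀ : Triple
v₋₁ = [ frac (+ 0) (+ 1) , frac (+ 1) (+ 1) , ∞ ]
w∞  = [ frac (+ 0) (+ 1) , frac (ℤ.- (+ 1)) (+ 1) , frac (ℤ.- (+ 1)) (+ 2) ]
w₀  = [ frac (ℤ.- (+ 2)) (+ 1) , frac (ℤ.- (+ 1)) (+ 1) , ∞ ]

fφ : ℚ∞ → ℚ∞
fφ q = frac (ℤ.- r q) (r q ℤ.+ d q)

fψ : ℚ∞ → ℚ∞
fψ q = frac (ℤ.- (r q ℤ.+ d q)) (d q)

module Submission where

-- Represent q ∈ ℚ∞ by the primitive integer vector (d q, r q).
-- The explicit maps fφ, fψ are then Möbius maps q ↦ M·(d q, r q) for
-- the matrices M = (0 −1; 1 1) and (−1 −1; 1 0) of determinant 1.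
--
-- 1. Farey neighbours p, q are those with D p q = d p·r q − d q·r p = ±1.
--    For neighbours the sign of D p q decides whether p < q, which turns
--    the order-based definition of a mutation into the algebraic rule
--      replace x y z = "y + ε·z"  with  ε = D x y · D x z
--    (a combination of representing vectors).  In particular mutations
--    keep triples unimodular, so every triple of 𝕋₃ⁱ is a Farey triple.
-- 2. A determinant-one Möbius map multiplies determinants by ±1 and is
--    linear on representing vectors, hence commutes with this rule; so
--    fφ and fψ, applied componentwise with the positions permuted,
--    intertwine μᵢ with μ_{σφ i}, resp. μ_{σψ i}, on Farey triples.
-- 3. An isomorphism out of 𝕋₃^{-1} respecting the edge relabelling σ
--    and agreeing with such an intertwining map at the base vertex agrees
--    with it everywhere, by induction along the tree.

open import Defs
open import Data.Bool using (Bool; true; false; if_then_else_; not; _∧_; _∨_)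
open import Data.Bool.Properties using (∧-comm; if-cong)
open import Data.Empty using (⊥-elim)
open import Data.Integer using (ℤ; +_; -[1+_]; ∣_∣; 1ℤ; 0ℤ; -1ℤ; _*_; _+_; _-_; -_; _<_; _≤_; +≤+)
import Data.Integer.Properties as ℤP
import Data.Integer.Divisibility.Signed as ℤS
open import Data.Integer.Tactic.RingSolver using (solve-∀)
open import Data.Nat as ℕ using (suc)
import Data.Nat.Properties as ℕP
import Data.Nat.Divisibility as ℕD
open import Data.Nat.Coprimality using (Coprime)
open import Data.Product using (_×_; _,_; Σ-syntax)
import Data.Rational as ℚ
import Data.Rational.Properties as ℚP
open import Data.Sum using (_⊎_; inj₁; inj₂)
open import Relation.Binary.PropositionalEquality
  using (_≡_; refl; sym; trans; cong; cong₂; subst; module ≡-Reasoning)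
open import Relation.Nullary using (¬_; yes; no)

open ≡-Reasoning

IsUnit : ℤ → Set
IsUnit z = z ≡ 1ℤ ⊎ z ≡ -1ℤ

abs≡1⇒unit : ∀ z → ∣ z ∣ ≡ 1 → IsUnit z
abs≡1⇒unit (+ 1)           _ = inj₁ refl
abs≡1⇒unit -[1+ 0 ]        _ = inj₂ refl
abs≡1⇒unit (+ 0)           ()
abs≡1⇒unit (+ suc (suc n)) ()
abs≡1⇒unit -[1+ suc n ]    ()

unit-* : ∀ {a b} → IsUnit a → IsUnit b → IsUnit (a * b)
unit-* (inj₁ refl) (inj₁ refl) = inj₁ refl
unit-* (inj₁ refl) (inj₂ refl) = inj₂ refl
unit-* (inj₂ refl) (inj₁ refl) = inj₂ refl
unit-* (inj₂ refl) (inj₂ refl) = inj₁ refl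

unit-neg : ∀ {a} → IsUnit a → IsUnit (- a)
unit-neg (inj₁ refl) = inj₂ refl
unit-neg (inj₂ refl) = inj₁ refl

unit-square : ∀ {a} → IsUnit a → a * a ≡ 1ℤ
unit-square (inj₁ refl) = refl
unit-square (inj₂ refl) = refl

isNeg : ∀ {e} → IsUnit e → Bool
isNeg (inj₁ _) = false
isNeg (inj₂ _) = true

-- The determinant of the representing vectors of p and q; p and q are
-- Farey neighbours exactly when it is a unit, since Δ p q = ∣ D p q ∣.
D : ℚ∞ → ℚ∞ → ℤ
D p q = d p * r q - d q * r p

D-antisym : ∀ p q → D q p ≡ - D p q
D-antisym p q = antisym (d p) (r p) (d q) (r q)
  where
  antisym : ∀ x y u v → u * y - x * v ≡ - (x * v - u * y)
  antisym = solve-∀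

unit-D-swap : ∀ p q → IsUnit (D p q) → IsUnit (D q p)
unit-D-swap p q u = subst IsUnit (sym (D-antisym p q)) (unit-neg u)

Primitive : ℤ → ℤ → Set
Primitive x y = Σ[ a ∈ ℤ ] Σ[ b ∈ ℤ ] a * x + b * y ≡ 1ℤ

unimodular⇒primitive : ∀ x y x' y' → IsUnit (x * y' - x' * y) → Primitive x y
unimodular⇒primitive x y x' y' (inj₁ e) = y' , - x' , trans (expand x y x' y') e
  where
  expand : ∀ x y x' y' → y' * x + - x' * y ≡ x * y' - x' * y
  expand = solve-∀
unimodular⇒primitive x y x' y' (inj₂ e) = - y' , x' , trans (expand x y x' y') (cong -_ e)
  where
  expand : ∀ x y x' y' → - y' * x + x' * y ≡ - (x * y' - x' * y)
  expand = solve-∀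

neighbour⇒primitive : ∀ p q → IsUnit (D p q) → Primitive (d p) (r p)
neighbour⇒primitive p q = unimodular⇒primitive (d p) (r p) (d q) (r q)

primitive⇒coprime : ∀ {x y} → Primitive x y → Coprime ∣ x ∣ ∣ y ∣
primitive⇒coprime {x} {y} (a , b , e) {i} (i∣x , i∣y) = ℕD.∣1⇒≡1 (ℤS.∣⇒∣ᵤ i∣1)
  where
  i∣1 : (+ i) ℤS.∣ 1ℤ
  i∣1 = subst ((+ i) ℤS.∣_) e
          (ℤS.∣m∣n⇒∣m+n (ℤS.∣n⇒∣m*n a (ℤS.∣ᵤ⇒∣ {+ i} i∣x))
                        (ℤS.∣n⇒∣m*n b (ℤS.∣ᵤ⇒∣ {+ i} i∣y)))

coprime-/ : ∀ x n → Coprime ∣ x ∣ (suc n) →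
            ℚ.↥ (x ℚ./ suc n) ≡ x × ℚ.↧ₙ (x ℚ./ suc n) ≡ suc n
coprime-/ (+ m)    n c rewrite ℚP.normalize-coprime {m} {n} c     = refl , refl
coprime-/ -[1+ m ] n c rewrite ℚP.normalize-coprime {suc m} {n} c = refl , refl

Represents : ℤ → ℤ → ℚ∞ → Set
Represents x y q = Σ[ s ∈ ℤ ] IsUnit s × d q ≡ s * x × r q ≡ s * y

primitive-x0 : ∀ x a b → a * x + b * + 0 ≡ 1ℤ → IsUnit x
primitive-x0 x a b e = abs≡1⇒unit x (ℕP.m*n≡1⇒n≡1 ∣ a ∣ ∣ x ∣ (begin
  ∣ a ∣ ℕ.* ∣ x ∣           ≡⟨ ℤP.abs-* a x ⟨
  ∣ a * x ∣                 ≡⟨ cong ∣_∣ (sym (ℤP.+-identityʳ (a * x))) ⟩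
  ∣ a * x + 0ℤ ∣            ≡⟨ cong (λ t → ∣ a * x + t ∣) (ℤP.*-zeroʳ b) ⟨
  ∣ a * x + b * + 0 ∣       ≡⟨ cong ∣_∣ e ⟩
  1                         ∎))

-- The point with a primitive representing vector (x, y) is represented
-- by it: frac only normalises the sign.
frac-represents : ∀ x y → Primitive x y → Represents x y (frac x y)
frac-represents x (+ 0) (a , b , e) with primitive-x0 x a b e
... | inj₁ refl = 1ℤ , inj₁ refl , refl , refl
... | inj₂ refl = -1ℤ , inj₂ refl , refl , refl
frac-represents x (+ suc n) p with coprime-/ x n (primitive⇒coprime p)
... | ↥≡x , ↧≡n = 1ℤ , inj₁ refl , trans ↥≡x (sym (ℤP.*-identityˡ x)) ,
                  trans (cong +_ ↧≡n) (sym (ℤP.*-identityˡ _))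
frac-represents x -[1+ n ] p with coprime-/ (- x) n (negate-coprime p)
  where
  negate-coprime : Primitive x -[1+ n ] → Coprime ∣ - x ∣ (suc n)
  negate-coprime p = subst (λ k → Coprime k (suc n)) (sym (ℤP.∣-i∣≡∣i∣ x)) (primitive⇒coprime p)
... | ↥≡-x , ↧≡n = -1ℤ , inj₂ refl , trans ↥≡-x (sym (ℤP.-1*i≡-i x)) ,
                   trans (cong +_ ↧≡n) (sym (ℤP.-1*i≡-i -[1+ n ]))

frac-neg : ∀ x y → frac (- x) (- y) ≡ frac x y
frac-neg x (+ 0)     = refl
frac-neg x (+ suc n) = cong (λ z → fin (z ℚ./ suc n)) (ℤP.neg-involutive x)
frac-neg x -[1+ n ]  = refl

frac-scale : ∀ {s} x y → IsUnit s → frac (s * x) (s * y) ≡ frac x y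
frac-scale x y (inj₁ refl) = cong₂ frac (ℤP.*-identityˡ x) (ℤP.*-identityˡ y)
frac-scale x y (inj₂ refl) =
  trans (cong₂ frac (ℤP.-1*i≡-i x) (ℤP.-1*i≡-i y)) (frac-neg x y)

-- Integer differences ∓1 decide the strict order; these are the facts
-- about cross-multiplied numerators behind the comparison of fractions.
diff≡-1⇒< : ∀ x y → x - y ≡ -1ℤ → x < y
diff≡-1⇒< x y e = ℤP.suc[i]≤j⇒i<j (ℤP.≤-reflexive (begin
  1ℤ + x               ≡⟨ shift x y ⟩
  (1ℤ + (x - y)) + y   ≡⟨ cong (λ z → (1ℤ + z) + y) e ⟩
  0ℤ + y               ≡⟨ ℤP.+-identityˡ y ⟩
  y                    ∎))
  where
  shift : ∀ x y → 1ℤ + x ≡ (1ℤ + (x - y)) + y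
  shift = solve-∀

diff≡1⇒≮ : ∀ x y → x - y ≡ 1ℤ → ¬ (x < y)
diff≡1⇒≮ x y e x<y with subst (_≤ 0ℤ) e (ℤP.i≤j⇒i-j≤0 (ℤP.<⇒≤ x<y))
... | +≤+ ()

D-∞-left : ∀ q → D ∞ (fin q) ≡ + ℚ.↧ₙ q
D-∞-left q = expand (+ ℚ.↧ₙ q) (ℚ.↥ q)
  where
  expand : ∀ n z → 1ℤ * n - z * 0ℤ ≡ n
  expand = solve-∀

D-∞-right : ∀ q → D (fin q) ∞ ≡ - (+ ℚ.↧ₙ q)
D-∞-right q = expand (+ ℚ.↧ₙ q) (ℚ.↥ q)
  where
  expand : ∀ n z → z * 0ℤ - 1ℤ * n ≡ - n
  expand = solve-∀

D≡-1⇒< : ∀ p q → D p q ≡ -1ℤ → (p <ᵇ q) ≡ true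
D≡-1⇒< (fin p) (fin q) e with p ℚP.<? q
... | yes _   = refl
... | no p≮q  = ⊥-elim (p≮q (ℚ.*<* (diff≡-1⇒< _ _ e)))
D≡-1⇒< (fin p) ∞       e = refl
D≡-1⇒< ∞       (fin q) e with trans (sym (D-∞-left q)) e
... | ()
D≡-1⇒< ∞       ∞       ()

D≡1⇒≮ : ∀ p q → D p q ≡ 1ℤ → (p <ᵇ q) ≡ false
D≡1⇒≮ (fin p) (fin q) e with p ℚP.<? q
... | yes (ℚ.*<* p<q) = ⊥-elim (diff≡1⇒≮ _ _ e p<q)
... | no _            = refl
D≡1⇒≮ (fin p) ∞       e with trans (sym (D-∞-right p)) e
... | ()
D≡1⇒≮ ∞       (fin q) e = refl
D≡1⇒≮ ∞       ∞       ()

<ᵇ-by-sign : ∀ p q (u : IsUnit (D p q)) → (p <ᵇ q) ≡ isNeg u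
<ᵇ-by-sign p q (inj₁ e) = D≡1⇒≮ p q e
<ᵇ-by-sign p q (inj₂ e) = D≡-1⇒< p q e

>ᵇ-by-sign : ∀ p q (u : IsUnit (D p q)) → (q <ᵇ p) ≡ not (isNeg u)
>ᵇ-by-sign p q (inj₁ e) = D≡-1⇒< q p (trans (D-antisym p q) (cong -_ e))
>ᵇ-by-sign p q (inj₂ e) = D≡1⇒≮ q p (trans (D-antisym p q) (cong -_ e))

combine : ℤ → ℚ∞ → ℚ∞ → ℚ∞
combine ε y z = frac (d y + ε * d z) (r y + ε * r z)

⊕-as-combine : ∀ y z → y ⊕ z ≡ combine 1ℤ y z
⊕-as-combine y z = cong₂ frac (cong (λ t → d y + t) (sym (ℤP.*-identityˡ (d z))))
                              (cong (λ t → r y + t) (sym (ℤP.*-identityˡ (r z))))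

⊖-as-combine : ∀ y z → y ⊖ z ≡ combine -1ℤ y z
⊖-as-combine y z = cong₂ frac (cong (λ t → d y + t) (sym (ℤP.-1*i≡-i (d z))))
                              (cong (λ t → r y + t) (sym (ℤP.-1*i≡-i (r z))))

-- x is the smallest or largest component exactly when the signs of
-- D x y and D x z agree, i.e. when their product is 1; then μ uses ⊕.
agree : Bool → Bool → Bool
agree a b = (a ∧ b) ∨ (not a ∧ not b)

agree-combine : ∀ {e₁ e₂} (u₁ : IsUnit e₁) (u₂ : IsUnit e₂) y z →
  (if agree (isNeg u₁) (isNeg u₂) then y ⊕ z else y ⊖ z) ≡ combine (e₁ * e₂) y z
agree-combine (inj₁ refl) (inj₁ refl) y z = ⊕-as-combine y z
agree-combine (inj₁ refl) (inj₂ refl) y z = ⊖-as-combine y z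
agree-combine (inj₂ refl) (inj₁ refl) y z = ⊖-as-combine y z
agree-combine (inj₂ refl) (inj₂ refl) y z = ⊕-as-combine y z

replace-as-combine : ∀ x y z → IsUnit (D x y) → IsUnit (D x z) →
  replace x y z ≡ combine (D x y * D x z) y z
replace-as-combine x y z u₁ u₂ = begin
  replace x y z
    ≡⟨ if-cong (cong₂ _∨_ (cong₂ _∧_ (<ᵇ-by-sign x y u₁) (<ᵇ-by-sign x z u₂))
                          (cong₂ _∧_ (>ᵇ-by-sign x y u₁) (>ᵇ-by-sign x z u₂))) ⟩
  (if agree (isNeg u₁) (isNeg u₂) then y ⊕ z else y ⊖ z)
    ≡⟨ agree-combine u₁ u₂ y z ⟩
  combine (D x y * D x z) y z
    ∎

replace-comm : ∀ x y z → replace x y z ≡ replace x z y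
replace-comm x y z = begin
  replace x y z
    ≡⟨ if-cong (cong₂ _∨_ (∧-comm (x <ᵇ y) (x <ᵇ z)) (∧-comm (y <ᵇ x) (z <ᵇ x))) ⟩
  (if cond x z y then y ⊕ z else y ⊖ z)
    ≡⟨ cong₂ (if cond x z y then_else_) ⊕-comm ⊖-comm ⟩
  replace x z y
    ∎
  where
  cond : ℚ∞ → ℚ∞ → ℚ∞ → Bool
  cond x y z = ((x <ᵇ y) ∧ (x <ᵇ z)) ∨ ((y <ᵇ x) ∧ (z <ᵇ x))
  swap : ∀ a b → a - b ≡ - (b - a)
  swap = solve-∀
  ⊕-comm : y ⊕ z ≡ z ⊕ y
  ⊕-comm = cong₂ frac (ℤP.+-comm (d y) (d z)) (ℤP.+-comm (r y) (r z))
  ⊖-comm : y ⊖ z ≡ z ⊖ y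
  ⊖-comm = trans (cong₂ frac (swap (d y) (d z)) (swap (r y) (r z)))
                 (frac-neg (d z - d y) (r z - r y))

-- "y + ε·z" is primitive when y, z are neighbours: its determinant with
-- the vector of z is still D y z.
combine-primitive : ∀ ε y z → IsUnit (D y z) → Primitive (d y + ε * d z) (r y + ε * r z)
combine-primitive ε y z u =
  unimodular⇒primitive _ _ (d z) (r z) (subst IsUnit (sym (shear (d y) (r y) (d z) (r z) ε)) u)
  where
  shear : ∀ dy ry dz rz ε → (dy + ε * dz) * rz - dz * (ry + ε * rz) ≡ dy * rz - dz * ry
  shear = solve-∀

combine-represents : ∀ ε y z → IsUnit (D y z) →
  Represents (d y + ε * d z) (r y + ε * r z) (combine ε y z)
combine-represents ε y z u = frac-represents _ _ (combine-primitive ε y z u)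

combine-neighbours : ∀ ε y z → IsUnit ε → IsUnit (D y z) →
  IsUnit (D (combine ε y z) y) × IsUnit (D (combine ε y z) z)
combine-neighbours ε y z uε uyz = neighbours (combine-represents ε y z uyz)
  where
  expand-y : ∀ s dy ry dz rz ε →
    (s * (dy + ε * dz)) * ry - dy * (s * (ry + ε * rz)) ≡ s * (ε * (dz * ry - dy * rz))
  expand-y = solve-∀
  expand-z : ∀ s dy ry dz rz ε →
    (s * (dy + ε * dz)) * rz - dz * (s * (ry + ε * rz)) ≡ s * (dy * rz - dz * ry)
  expand-z = solve-∀
  neighbours : Represents (d y + ε * d z) (r y + ε * r z) (combine ε y z) →
    IsUnit (D (combine ε y z) y) × IsUnit (D (combine ε y z) z)
  neighbours (s , us , d≡ , r≡) =
    subst IsUnit (sym (trans (cong₂ (λ a b → a * r y - d y * b) d≡ r≡)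
                             (expand-y s (d y) (r y) (d z) (r z) ε)))
      (unit-* us (unit-* uε (unit-D-swap y z uyz))) ,
    subst IsUnit (sym (trans (cong₂ (λ a b → a * r z - d z * b) d≡ r≡)
                             (expand-z s (d y) (r y) (d z) (r z) ε)))
      (unit-* us uyz)

replace-neighbours : ∀ x y z → IsUnit (D x y) → IsUnit (D x z) → IsUnit (D y z) →
  IsUnit (D (replace x y z) y) × IsUnit (D (replace x y z) z)
replace-neighbours x y z uxy uxz uyz =
  subst (λ w → IsUnit (D w y) × IsUnit (D w z)) (sym (replace-as-combine x y z uxy uxz))
        (combine-neighbours (D x y * D x z) y z (unit-* uxy uxz) uyz)

Unimodular : Triple → Set
Unimodular [ a , b , c ] = IsUnit (D a b) × IsUnit (D b c) × IsUnit (D a c)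

μ-unimodular : ∀ i t → Unimodular t → Unimodular (μ i t)
μ-unimodular ℓ0 [ a , b , c ] (uab , ubc , uac) =
  let (ua'b , ua'c) = replace-neighbours a b c uab uac ubc
  in ua'b , ubc , ua'c
μ-unimodular ℓ-1 [ a , b , c ] (uab , ubc , uac) =
  let (ub'a , ub'c) = replace-neighbours b a c (unit-D-swap a b uab) ubc uac
  in unit-D-swap _ a ub'a , ub'c , uac
μ-unimodular ℓ∞ [ a , b , c ] (uab , ubc , uac) =
  let (uc'a , uc'b) = replace-neighbours c a b (unit-D-swap a c uac) (unit-D-swap b c ubc) uab
  in uab , unit-D-swap _ b uc'b , unit-D-swap _ a uc'a

root-unimodular : Unimodular root
root-unimodular = inj₁ refl , inj₂ refl , inj₂ refl

𝕋-unimodular : ∀ {i} t → In𝕋 i t → Unimodular t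
𝕋-unimodular {i} _ base         = μ-unimodular i root root-unimodular
𝕋-unimodular     _ (step j p _) = μ-unimodular j _ (𝕋-unimodular _ p)

module Möbius (m₁₁ m₁₂ m₂₁ m₂₂ : ℤ) (det : m₁₁ * m₂₂ - m₁₂ * m₂₁ ≡ 1ℤ)
              (f : ℚ∞ → ℚ∞)
              (f-def : ∀ q → f q ≡ frac (m₁₁ * d q + m₁₂ * r q) (m₂₁ * d q + m₂₂ * r q))
              where

  M₁ M₂ : ℤ → ℤ → ℤ
  M₁ x y = m₁₁ * x + m₁₂ * y
  M₂ x y = m₂₁ * x + m₂₂ * y

  -- The matrix is invertible over ℤ, so it preserves primitivity.
  M-primitive : ∀ {x y} → Primitive x y → Primitive (M₁ x y) (M₂ x y)
  M-primitive {x} {y} (a , b , e) = a * m₂₂ - b * m₂₁ , b * m₁₁ - a * m₁₂ ,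
    trans (inverse m₁₁ m₁₂ m₂₁ m₂₂ a b x y) (cong₂ _*_ det e)
    where
    inverse : ∀ m₁₁ m₁₂ m₂₁ m₂₂ a b x y →
      (a * m₂₂ - b * m₂₁) * (m₁₁ * x + m₁₂ * y) + (b * m₁₁ - a * m₁₂) * (m₂₁ * x + m₂₂ * y)
      ≡ (m₁₁ * m₂₂ - m₁₂ * m₂₁) * (a * x + b * y)
    inverse = solve-∀

  f-represents : ∀ q → Primitive (d q) (r q) → Represents (M₁ (d q) (r q)) (M₂ (d q) (r q)) (f q)
  f-represents q p rewrite f-def q = frac-represents _ _ (M-primitive p)

  f-frac : ∀ x y → Primitive x y → f (frac x y) ≡ frac (M₁ x y) (M₂ x y)
  f-frac x y p with frac-represents x y p
  ... | s , us , d≡ , r≡ = begin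
    f (frac x y)                                   ≡⟨ f-def (frac x y) ⟩
    frac (M₁ (d (frac x y)) (r (frac x y)))
         (M₂ (d (frac x y)) (r (frac x y)))         ≡⟨ cong₂ (λ a b → frac (M₁ a b) (M₂ a b)) d≡ r≡ ⟩
    frac (M₁ (s * x) (s * y)) (M₂ (s * x) (s * y))  ≡⟨ cong₂ frac (linear m₁₁ m₁₂ s x y) (linear m₂₁ m₂₂ s x y) ⟩
    frac (s * M₁ x y) (s * M₂ x y)                  ≡⟨ frac-scale _ _ us ⟩
    frac (M₁ x y) (M₂ x y)                          ∎
    where
    linear : ∀ m n s x y → m * (s * x) + n * (s * y) ≡ s * (m * x + n * y)
    linear = solve-∀

  D-image : ∀ p q sp sq →
    d (f p) ≡ sp * M₁ (d p) (r p) → r (f p) ≡ sp * M₂ (d p) (r p) →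
    d (f q) ≡ sq * M₁ (d q) (r q) → r (f q) ≡ sq * M₂ (d q) (r q) →
    D (f p) (f q) ≡ sp * sq * D p q
  D-image p q sp sq dp≡ rp≡ dq≡ rq≡ = begin
    D (f p) (f q)
      ≡⟨ cong₂ _-_ (cong₂ _*_ dp≡ rq≡) (cong₂ _*_ dq≡ rp≡) ⟩
    (sp * M₁ (d p) (r p)) * (sq * M₂ (d q) (r q)) - (sq * M₁ (d q) (r q)) * (sp * M₂ (d p) (r p))
      ≡⟨ multiplicative m₁₁ m₁₂ m₂₁ m₂₂ sp sq (d p) (r p) (d q) (r q) ⟩
    (sp * sq) * ((m₁₁ * m₂₂ - m₁₂ * m₂₁) * D p q)
      ≡⟨ cong (λ t → (sp * sq) * (t * D p q)) det ⟩
    (sp * sq) * (1ℤ * D p q)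
      ≡⟨ cong ((sp * sq) *_) (ℤP.*-identityˡ (D p q)) ⟩
    sp * sq * D p q
      ∎
    where
    multiplicative : ∀ m₁₁ m₁₂ m₂₁ m₂₂ sp sq dp rp dq rq →
      (sp * (m₁₁ * dp + m₁₂ * rp)) * (sq * (m₂₁ * dq + m₂₂ * rq))
        - (sq * (m₁₁ * dq + m₁₂ * rq)) * (sp * (m₂₁ * dp + m₂₂ * rp))
      ≡ (sp * sq) * ((m₁₁ * m₂₂ - m₁₂ * m₂₁) * (dp * rq - dq * rp))
    multiplicative = solve-∀

  -- One coordinate of "f y + (D fx fy · D fx fz)·f z", written in terms of
  -- the representations: the signs of x and z cancel, that of y factors out.
  image-combine : ∀ m n sx sy sz A B dy ry dz rz → sx * sx ≡ 1ℤ → sz * sz ≡ 1ℤ →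
    sy * (m * dy + n * ry) + ((sx * sy) * A * ((sx * sz) * B)) * (sz * (m * dz + n * rz))
    ≡ sy * (m * (dy + (A * B) * dz) + n * (ry + (A * B) * rz))
  image-combine m n sx sy sz A B dy ry dz rz sx²≡1 sz²≡1 = begin
    sy * (m * dy + n * ry) + ((sx * sy) * A * ((sx * sz) * B)) * (sz * (m * dz + n * rz))
      ≡⟨ collect m n sx sy sz A B dy ry dz rz ⟩
    sy * ((m * dy + n * ry) + ((sx * sx) * (sz * sz)) * ((A * B) * (m * dz + n * rz)))
      ≡⟨ cong (λ k → sy * ((m * dy + n * ry) + k * ((A * B) * (m * dz + n * rz))))
              (cong₂ _*_ sx²≡1 sz²≡1) ⟩
    sy * ((m * dy + n * ry) + 1ℤ * ((A * B) * (m * dz + n * rz)))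
      ≡⟨ cong (sy *_) (distribute m n (A * B) dy ry dz rz) ⟩
    sy * (m * (dy + (A * B) * dz) + n * (ry + (A * B) * rz))
      ∎
    where
    collect : ∀ m n sx sy sz A B dy ry dz rz →
      sy * (m * dy + n * ry) + ((sx * sy) * A * ((sx * sz) * B)) * (sz * (m * dz + n * rz))
      ≡ sy * ((m * dy + n * ry) + ((sx * sx) * (sz * sz)) * ((A * B) * (m * dz + n * rz)))
    collect = solve-∀
    distribute : ∀ m n ε dy ry dz rz →
      (m * dy + n * ry) + 1ℤ * (ε * (m * dz + n * rz)) ≡ m * (dy + ε * dz) + n * (ry + ε * rz)
    distribute = solve-∀

  commute : ∀ x y z → IsUnit (D x y) → IsUnit (D x z) → IsUnit (D y z) →
            replace (f x) (f y) (f z) ≡ f (replace x y z)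
  commute x y z uxy uxz uyz =
    via (f-represents x (neighbour⇒primitive x y uxy))
        (f-represents y (neighbour⇒primitive y z uyz))
        (f-represents z (neighbour⇒primitive z x (unit-D-swap x z uxz)))
    where
    ε : ℤ
    ε = D x y * D x z
    via : Represents (M₁ (d x) (r x)) (M₂ (d x) (r x)) (f x) →
          Represents (M₁ (d y) (r y)) (M₂ (d y) (r y)) (f y) →
          Represents (M₁ (d z) (r z)) (M₂ (d z) (r z)) (f z) →
          replace (f x) (f y) (f z) ≡ f (replace x y z)
    via (sx , ux , dx≡ , rx≡) (sy , uy , dy≡ , ry≡) (sz , uz , dz≡ , rz≡) = begin
      replace (f x) (f y) (f z)
        ≡⟨ replace-as-combine (f x) (f y) (f z) ufxy ufxz ⟩
      combine (D (f x) (f y) * D (f x) (f z)) (f y) (f z)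
        ≡⟨ cong₂ frac (coordinate m₁₁ m₁₂ dy≡ dz≡) (coordinate m₂₁ m₂₂ ry≡ rz≡) ⟩
      frac (sy * M₁ (d y + ε * d z) (r y + ε * r z)) (sy * M₂ (d y + ε * d z) (r y + ε * r z))
        ≡⟨ frac-scale _ _ uy ⟩
      frac (M₁ (d y + ε * d z) (r y + ε * r z)) (M₂ (d y + ε * d z) (r y + ε * r z))
        ≡⟨ f-frac _ _ (combine-primitive ε y z uyz) ⟨
      f (combine ε y z)
        ≡⟨ cong f (replace-as-combine x y z uxy uxz) ⟨
      f (replace x y z)
        ∎
      where
      Dxy≡ : D (f x) (f y) ≡ sx * sy * D x y
      Dxy≡ = D-image x y sx sy dx≡ rx≡ dy≡ ry≡
      Dxz≡ : D (f x) (f z) ≡ sx * sz * D x z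
      Dxz≡ = D-image x z sx sz dx≡ rx≡ dz≡ rz≡
      ufxy : IsUnit (D (f x) (f y))
      ufxy = subst IsUnit (sym Dxy≡) (unit-* (unit-* ux uy) uxy)
      ufxz : IsUnit (D (f x) (f z))
      ufxz = subst IsUnit (sym Dxz≡) (unit-* (unit-* ux uz) uxz)
      coordinate : ∀ m n {ay az} → ay ≡ sy * (m * d y + n * r y) → az ≡ sz * (m * d z + n * r z) →
        ay + (D (f x) (f y) * D (f x) (f z)) * az ≡ sy * (m * (d y + ε * d z) + n * (r y + ε * r z))
      coordinate m n ay≡ az≡ =
        trans (cong₂ _+_ ay≡ (cong₂ _*_ (cong₂ _*_ Dxy≡ Dxz≡) az≡))
              (image-combine m n sx sy sz (D x y) (D x z) (d y) (r y) (d z) (r z)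
                             (unit-square ux) (unit-square uz))

fφ-matrix : ∀ q → fφ q ≡ frac (0ℤ * d q + - 1ℤ * r q) (1ℤ * d q + 1ℤ * r q)
fφ-matrix q = cong₂ frac (numerator (d q) (r q)) (denominator (d q) (r q))
  where
  numerator : ∀ x y → - y ≡ 0ℤ * x + - 1ℤ * y
  numerator = solve-∀
  denominator : ∀ x y → y + x ≡ 1ℤ * x + 1ℤ * y
  denominator = solve-∀

fψ-matrix : ∀ q → fψ q ≡ frac (- 1ℤ * d q + - 1ℤ * r q) (1ℤ * d q + 0ℤ * r q)
fψ-matrix q = cong₂ frac (numerator (d q) (r q)) (denominator (d q) (r q))
  where
  numerator : ∀ x y → - (y + x) ≡ - 1ℤ * x + - 1ℤ * y
  numerator = solve-∀
  denominator : ∀ x y → x ≡ 1ℤ * x + 0ℤ * y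
  denominator = solve-∀

module MöbiusΦ = Möbius 0ℤ (- 1ℤ) 1ℤ 1ℤ refl fφ fφ-matrix
module MöbiusΨ = Möbius (- 1ℤ) (- 1ℤ) 1ℤ 0ℤ refl fψ fψ-matrix

Φ : Triple → Triple
Φ [ a , b , c ] = [ fφ c , fφ a , fφ b ]

Ψ : Triple → Triple
Ψ [ a , b , c ] = [ fψ b , fψ c , fψ a ]

Φ-commutes : ∀ i t → Unimodular t → μ (σφ i) (Φ t) ≡ Φ (μ i t)
Φ-commutes ℓ0 [ a , b , c ] (uab , ubc , uac) =
  cong (λ v → [ fφ c , v , fφ b ])
       (trans (replace-comm (fφ a) (fφ c) (fφ b)) (MöbiusΦ.commute a b c uab uac ubc))
Φ-commutes ℓ-1 [ a , b , c ] (uab , ubc , uac) =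
  cong (λ v → [ fφ c , fφ a , v ])
       (trans (replace-comm (fφ b) (fφ c) (fφ a))
              (MöbiusΦ.commute b a c (unit-D-swap a b uab) ubc uac))
Φ-commutes ℓ∞ [ a , b , c ] (uab , ubc , uac) =
  cong (λ v → [ v , fφ a , fφ b ])
       (MöbiusΦ.commute c a b (unit-D-swap a c uac) (unit-D-swap b c ubc) uab)

Ψ-commutes : ∀ i t → Unimodular t → μ (σψ i) (Ψ t) ≡ Ψ (μ i t)
Ψ-commutes ℓ0 [ a , b , c ] (uab , ubc , uac) =
  cong (λ v → [ fψ b , fψ c , v ]) (MöbiusΨ.commute a b c uab uac ubc)
Ψ-commutes ℓ-1 [ a , b , c ] (uab , ubc , uac) =
  cong (λ v → [ v , fψ c , fψ a ])
       (trans (replace-comm (fψ b) (fψ c) (fψ a))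
              (MöbiusΨ.commute b a c (unit-D-swap a b uab) ubc uac))
Ψ-commutes ℓ∞ [ a , b , c ] (uab , ubc , uac) =
  cong (λ v → [ fψ b , v , fψ a ])
       (trans (replace-comm (fψ c) (fψ b) (fψ a))
              (MöbiusΨ.commute c a b (unit-D-swap a c uac) (unit-D-swap b c ubc) uab))

agrees-on-𝕋 : ∀ {j w σ φ} (F : Triple → Triple) → IsGraphIso j v₋₁ w σ φ → F v₋₁ ≡ w →
  (∀ i t → Unimodular t → μ (σ i) (F t) ≡ F (μ i t)) →
  ∀ t → In𝕋 ℓ-1 t → φ t ≡ F t
agrees-on-𝕋 F iso F-base F-commutes _ base =
  trans (IsGraphIso.sends-base iso) (sym F-base)
agrees-on-𝕋 {σ = σ} {φ} F iso F-base F-commutes _ (step {t} i p t≢root) = begin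
  φ (μ i t)       ≡⟨ IsGraphIso.edges iso t i p (step i p t≢root) ⟩
  μ (σ i) (φ t)   ≡⟨ cong (μ (σ i)) (agrees-on-𝕋 F iso F-base F-commutes t p) ⟩
  μ (σ i) (F t)   ≡⟨ F-commutes i t (𝕋-unimodular t p) ⟩
  F (μ i t)       ∎

mainTheorem4 :
    ((φ : Triple → Triple) → IsGraphIso ℓ∞ v₋₁ w∞ σφ φ →
      ∀ q₀ q₋₁ q∞ → IsFareyTriple [ q₀ , q₋₁ , q∞ ] → In𝕋 ℓ-1 [ q₀ , q₋₁ , q∞ ] →
      φ [ q₀ , q₋₁ , q∞ ] ≡ [ fφ q∞ , fφ q₀ , fφ q₋₁ ])
    ×
    ((ψ : Triple → Triple) → IsGraphIso ℓ0 v₋₁ w₀ σψ ψ →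
      ∀ q₀ q₋₁ q∞ → IsFareyTriple [ q₀ , q₋₁ , q∞ ] → In𝕋 ℓ-1 [ q₀ , q₋₁ , q∞ ] →
      ψ [ q₀ , q₋₁ , q∞ ] ≡ [ fψ q₋₁ , fψ q∞ , fψ q₀ ])
mainTheorem4 =
  (λ φ iso _ _ _ _ p → agrees-on-𝕋 Φ iso refl Φ-commutes _ p) ,
  (λ ψ iso _ _ _ _ p → agrees-on-𝕋 Ψ iso refl Ψ-commutes _ p)
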